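{- Let $n,k,t$ be positive integers with $t\ge n$, $\frac{n(n+1)}{2}=k\cdot t$, $n$ odd and $2k\mid n+1$. The algorithm $\mathtt{meanderodd}(n,k,t)$ (a) outputs sets $T_1,\dots,T_k$ that are pairwise disjoint, whose union is $\{0,1,\dots,n\}$, and with $\sum_{x\in T_j}x=t$ for each $j$ (so they give a $(k,t)$-partition of $\{1,\dots,n\}$ after discarding the element $0$); and (b) needs $\mathcal{O}(n)$ steps to insert the elements into the sets $T_j$.
   Context: $\mathtt{meanderodd}(n,k,t)$: start with $T_j=\emptyset$ for $1\le j\le k$; for $j=1,\dots,k$ and $i=1,\dots,\frac{n+1}{2k}$, insert the element $2ki-j$ and the element $2k(i-1)+(j-1)$ into $T_j$. (The element $0$ is thereby inserted into $T_1$; by convention the ground set is taken to contain $0$.) -}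

module Defs where

open import Data.Nat using (ℕ; zero; suc; _+_; _*_; _∸_; _/_)
open import Data.Fin using (Fin; toℕ)
open import Data.List using (List; []; _∷_; _++_; concatMap; map; length; allFin)
open import Data.Nat.ListAction using (sum)

-- Number of iterations of the inner loop: (n+1)/(2k)  (0 if k = 0, never used then).
iters : ℕ → ℕ → ℕ
iters n zero    = 0
iters n (suc k) = (n + 1) / (2 * suc k)

oneTo : ℕ → List ℕ
oneTo zero    = []
oneTo (suc m) = oneTo m ++ (suc m ∷ [])

-- meanderodd(n,k,t): the set T_j for j = toℕ j' + 1, as the list of inserted
-- elements in insertion order (for i = 1..(n+1)/(2k): insert 2ki-j, then 2k(i-1)+(j-1)).
-- The parameter t is not used by the algorithm.
meanderodd : (n k t : ℕ) → Fin k → List ℕ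
meanderodd n k t j' =
  concatMap (λ i → (2 * k * i ∸ j) ∷ (2 * k * (i ∸ 1) + (j ∸ 1)) ∷ []) (oneTo (iters n k))
  where
    j : ℕ
    j = suc (toℕ j')

-- Number of insertion steps performed by meanderodd(n,k,t):
-- one step per inserted element, summed over all sets T_1..T_k.
meanderoddSteps : (n k t : ℕ) → ℕ
meanderoddSteps n k t = sum (map (λ j → length (meanderodd n k t j)) (allFin k))

module Submission where

-- Write d = 2k and m = (n+1)/(2k), so that n + 1 = d·m.  For the
-- set T_{j+1} (0 ≤ j < k) the i-th round of meanderodd inserts d(i-1) + (d-1-j)
-- and d(i-1) + j, so T_{j+1} consists of the numbers d·q + r with q < m and r
-- one of the two "digits" j and its mirror image d-1-j.  Everything follows:
--   * the pairs {j, d-1-j} for j < k partition the residues 0..d-1, which gives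
--     disjointness (by uniqueness of remainders) and coverage of 0..d·m-1 = 0..n;
--   * two distinct digits make each T_{j+1} duplicate-free;
--   * each round inserts 2dq + (d-1), so sum T_{j+1} = d·m² - m = n·m = t;
--   * each T_{j+1} receives 2m insertions, i.e. k·2m = n+1 ≤ 2n in total.

open import Defs
open import Data.Nat using (ℕ; zero; suc; _+_; _*_; _∸_; _/_; _%_; _≤_; _<_; NonZero; s≤s; s≤s⁻¹; z<s; _<?_; >-nonZero)
open import Data.Nat.Properties
open import Data.Nat.DivMod using (m≡m%n+[m/n]*n; [m+kn]%n≡m%n; m<n⇒m%n≡m; m%n<n; m<n*o⇒m/o<n; m*n/n≡m)
open import Data.Nat.Divisibility using (_∣_; m∣n⇒n≡quotient*m; quotient)
open import Data.Nat.ListAction using (sum)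
open import Data.Nat.ListAction.Properties using (sum-++)
open import Data.Nat.Solver using (module +-*-Solver)
open import Data.Fin using (Fin; toℕ; fromℕ<)
open import Data.Fin.Properties using (toℕ-injective; toℕ<n; toℕ-fromℕ<)
open import Data.List using (List; []; _∷_; _++_; concatMap; map; length; allFin)
open import Data.List.Properties using (concatMap-++; length-++; length-tabulate)
open import Data.List.Membership.Propositional using (_∈_)
open import Data.List.Membership.Propositional.Properties using (∈-++⁺ˡ; ∈-++⁺ʳ; ∈-++⁻)
open import Data.List.Relation.Unary.Any using (here; there)
open import Data.List.Relation.Unary.AllPairs using ([]; _∷_)
open import Data.List.Relation.Unary.All using ([]; _∷_)
open import Data.List.Relation.Unary.Unique.Propositional using (Unique)
open import Data.List.Relation.Unary.Unique.Propositional.Properties using (++⁺)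
open import Data.List.Relation.Binary.Disjoint.Propositional using (Disjoint)
open import Data.Product using (_×_; ∃₂; ∃-syntax; _,_)
open import Data.Sum using (_⊎_; inj₁; inj₂)
open import Data.Empty using (⊥-elim)
open import Relation.Nullary using (¬_; yes; no)
open import Relation.Binary.PropositionalEquality
open import Function.Bundles using (_⇔_; mk⇔)

open +-*-Solver

remainder-unique : ∀ d {q q′ r r′} → r < d → r′ < d → d * q + r ≡ d * q′ + r′ → r ≡ r′
remainder-unique d {q} {q′} {r} {r′} r<d r′<d eq = trans (sym (remainder-of q r<d)) (trans (cong (_% d) eq) (remainder-of q′ r′<d))
  where
  instance
    d≢0 : NonZero d
    d≢0 = >-nonZero (m<n⇒0<n r<d)
  remainder-of : ∀ p {s} → s < d → (d * p + s) % d ≡ s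
  remainder-of p {s} s<d = begin
    (d * p + s) % d  ≡⟨ cong (_% d) (trans (+-comm (d * p) s) (cong (s +_) (*-comm d p))) ⟩
    (s + p * d) % d  ≡⟨ [m+kn]%n≡m%n s p d ⟩
    s % d            ≡⟨ m<n⇒m%n≡m s<d ⟩
    s                ∎
    where open ≡-Reasoning

division : ∀ x d .{{_ : NonZero d}} → x ≡ d * (x / d) + x % d
division x d = trans (m≡m%n+[m/n]*n x d) (trans (+-comm (x % d) _) (cong (_+ x % d) (*-comm (x / d) d)))

block-< : ∀ d {q m r} → q < m → r < d → d * q + r < d * m
block-< d {q} {m} {r} q<m r<d = begin-strict
  d * q + r  <⟨ +-monoʳ-< (d * q) r<d ⟩
  d * q + d  ≡⟨ trans (+-comm (d * q) d) (sym (*-suc d q)) ⟩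
  d * suc q  ≤⟨ *-monoʳ-≤ d q<m ⟩
  d * m      ∎
  where open ≤-Reasoning

sum-map-constant : ∀ {A : Set} {f : A → ℕ} {c} (xs : List A) → (∀ x → f x ≡ c) → sum (map f xs) ≡ length xs * c
sum-map-constant []       f≡c = refl
sum-map-constant (x ∷ xs) f≡c = cong₂ _+_ (f≡c x) (sum-map-constant xs f≡c)

Digit : ℕ → ℕ → ℕ → Set
Digit a b r = r ≡ a ⊎ r ≡ b

pairBlocks : (d a b m : ℕ) → List ℕ
pairBlocks d a b zero    = []
pairBlocks d a b (suc m) = pairBlocks d a b m ++ (d * m + a) ∷ (d * m + b) ∷ []

module _ {d a b : ℕ} where

  ∈-pairBlocks⁻ : ∀ m {x} → x ∈ pairBlocks d a b m → ∃₂ λ q r → q < m × Digit a b r × x ≡ d * q + r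
  ∈-pairBlocks⁻ (suc m) x∈ with ∈-++⁻ (pairBlocks d a b m) x∈
  ... | inj₁ x∈old with ∈-pairBlocks⁻ m x∈old
  ...   | q , r , q<m , digit , x≡ = q , r , m<n⇒m<1+n q<m , digit , x≡
  ∈-pairBlocks⁻ (suc m) x∈ | inj₂ (here x≡)         = m , a , ≤-refl , inj₁ refl , x≡
  ∈-pairBlocks⁻ (suc m) x∈ | inj₂ (there (here x≡)) = m , b , ≤-refl , inj₂ refl , x≡

  ∈-pairBlocks⁺ : ∀ {m q r} → q < m → Digit a b r → d * q + r ∈ pairBlocks d a b m
  ∈-pairBlocks⁺ {suc m} {q} q<1+m digit with m≤n⇒m<n∨m≡n (s≤s⁻¹ q<1+m)
  ... | inj₁ q<m = ∈-++⁺ˡ (∈-pairBlocks⁺ q<m digit)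
  ∈-pairBlocks⁺ {suc m} q<1+m (inj₁ refl) | inj₂ refl = ∈-++⁺ʳ (pairBlocks d a b m) (here refl)
  ∈-pairBlocks⁺ {suc m} q<1+m (inj₂ refl) | inj₂ refl = ∈-++⁺ʳ (pairBlocks d a b m) (there (here refl))

  pairBlocks-< : a < d → b < d → ∀ {m x} → x ∈ pairBlocks d a b m → x < d * m
  pairBlocks-< a<d b<d {m} x∈ with ∈-pairBlocks⁻ m x∈
  ... | q , r , q<m , inj₁ refl , refl = block-< d q<m a<d
  ... | q , r , q<m , inj₂ refl , refl = block-< d q<m b<d

  -- Distinct digits below d give a list without repetitions: the two elements
  -- of a new block differ and exceed everything inserted earlier.
  pairBlocks-unique : a ≢ b → a < d → b < d → ∀ m → Unique (pairBlocks d a b m)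
  pairBlocks-unique a≢b a<d b<d zero    = []
  pairBlocks-unique a≢b a<d b<d (suc m) =
    ++⁺ (pairBlocks-unique a≢b a<d b<d m) ((new-distinct ∷ []) ∷ [] ∷ []) old-below-new
    where
    new-distinct : d * m + a ≢ d * m + b
    new-distinct eq = a≢b (+-cancelˡ-≡ (d * m) a b eq)
    new-above : ∀ {x} → x ∈ (d * m + a) ∷ (d * m + b) ∷ [] → d * m ≤ x
    new-above (here refl)         = m≤m+n (d * m) a
    new-above (there (here refl)) = m≤m+n (d * m) b
    old-below-new : Disjoint (pairBlocks d a b m) ((d * m + a) ∷ (d * m + b) ∷ [])
    old-below-new (x∈old , x∈new) = <⇒≱ (pairBlocks-< a<d b<d x∈old) (new-above x∈new)

  pairBlocks-length : ∀ m → length (pairBlocks d a b m) ≡ 2 * m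
  pairBlocks-length zero    = refl
  pairBlocks-length (suc m) = begin
    length (pairBlocks d a b m ++ _)  ≡⟨ length-++ (pairBlocks d a b m) ⟩
    length (pairBlocks d a b m) + 2   ≡⟨ cong (_+ 2) (pairBlocks-length m) ⟩
    2 * m + 2                         ≡⟨ solve 1 (λ m → con 2 :* m :+ con 2 := con 2 :* (con 1 :+ m)) refl m ⟩
    2 * suc m                         ∎
    where open ≡-Reasoning

  -- Complementary digits (a + b = d - 1): block q contributes 2dq + d - 1,
  -- so the first m blocks sum to d·m² - m.
  pairBlocks-sum : a + suc b ≡ d → ∀ m → sum (pairBlocks d a b m) + m ≡ d * m * m
  pairBlocks-sum complementary zero    = sym (*-zeroʳ (d * 0))
  pairBlocks-sum complementary (suc m) = begin
    sum (pairBlocks d a b m ++ new) + suc m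
      ≡⟨ cong (_+ suc m) (sum-++ (pairBlocks d a b m) new) ⟩
    S + (d * m + a + (d * m + b + 0)) + suc m
      ≡⟨ solve 5 (λ S m a b d → S :+ (d :* m :+ a :+ (d :* m :+ b :+ con 0)) :+ (con 1 :+ m)
                 := (S :+ m) :+ (d :* m :+ d :* m) :+ (a :+ (con 1 :+ b))) refl S m a b d ⟩
    (S + m) + (d * m + d * m) + (a + suc b)
      ≡⟨ cong₂ (λ x y → x + (d * m + d * m) + y) (pairBlocks-sum complementary m) complementary ⟩
    d * m * m + (d * m + d * m) + d
      ≡⟨ solve 2 (λ m d → d :* m :* m :+ (d :* m :+ d :* m) :+ d := d :* (con 1 :+ m) :* (con 1 :+ m)) refl m d ⟩
    d * suc m * suc m ∎
    where
    open ≡-Reasoning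
    new : List ℕ
    new = (d * m + a) ∷ (d * m + b) ∷ []
    S : ℕ
    S = sum (pairBlocks d a b m)

-- The digit pairing modulo 2k: j < k is paired with its mirror image 2k-1-j.
mirror : ℕ → ℕ → ℕ
mirror k j = 2 * k ∸ suc j

module _ {k : ℕ} where

  -- 2 * k unfolds to k + (k + 0); these lemmas fix the arithmetic of 2k.
  2k≡k+k : 2 * k ≡ k + k
  2k≡k+k = cong (k +_) (+-identityʳ k)

  <k⇒<2k : ∀ {j} → j < k → j < 2 * k
  <k⇒<2k j<k = ≤-trans j<k (m≤m+n k (k + 0))

  mirror-complement : ∀ {r} → r < 2 * k → mirror k r + suc r ≡ 2 * k
  mirror-complement r<2k = m∸n+n≡m r<2k

  mirror-< : ∀ {j} → j < k → mirror k j < 2 * k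
  mirror-< j<k = ∸-monoʳ-< z<s (<k⇒<2k j<k)

  mirror-involutive : ∀ {r} → r < 2 * k → mirror k (mirror k r) ≡ r
  mirror-involutive {r} r<2k = begin
    2 * k ∸ suc (2 * k ∸ suc r)  ≡⟨ cong (2 * k ∸_) (sym (+-∸-assoc 1 r<2k)) ⟩
    2 * k ∸ (2 * k ∸ r)          ≡⟨ m∸[m∸n]≡n (<⇒≤ r<2k) ⟩
    r                            ∎
    where open ≡-Reasoning

  no-straddle : ∀ {i j} → i < k → j < k → i + suc j ≢ 2 * k
  no-straddle i<k j<k eq = <-irrefl (trans eq 2k≡k+k) (+-mono-≤ i<k j<k)

  -- Hence the two digits of a pair are distinct (2j + 1 ≠ 2k).
  mirror≢ : ∀ {j} → j < k → mirror k j ≢ j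
  mirror≢ {j} j<k eq = no-straddle j<k j<k (trans (cong (_+ suc j) (sym eq)) (mirror-complement (<k⇒<2k j<k)))

  mirror-≥k : ∀ {r} → k ≤ r → r < 2 * k → mirror k r < k
  mirror-≥k {r} k≤r r<2k = +-cancelʳ-≤ k (suc (mirror k r)) k (begin
    suc (mirror k r) + k  ≤⟨ +-monoʳ-≤ (suc (mirror k r)) k≤r ⟩
    suc (mirror k r) + r  ≡⟨ sym (+-suc (mirror k r) r) ⟩
    mirror k r + suc r    ≡⟨ mirror-complement r<2k ⟩
    2 * k                 ≡⟨ 2k≡k+k ⟩
    k + k                 ∎)
    where open ≤-Reasoning

  digit-injective : ∀ {i j r} → i < k → j < k → Digit (mirror k i) i r → Digit (mirror k j) j r → i ≡ j
  digit-injective i<k j<k (inj₂ refl) (inj₂ refl) = refl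
  digit-injective {i} {j} i<k j<k (inj₁ r≡) (inj₂ refl) =
    ⊥-elim (no-straddle j<k i<k (trans (cong (_+ suc i) r≡) (mirror-complement (<k⇒<2k i<k))))
  digit-injective {i} {j} i<k j<k (inj₂ refl) (inj₁ r≡) =
    ⊥-elim (no-straddle i<k j<k (trans (cong (_+ suc j) r≡) (mirror-complement (<k⇒<2k j<k))))
  digit-injective {i} {j} {r} i<k j<k (inj₁ r≡) (inj₁ r≡′) = suc-injective (+-cancelˡ-≡ r (suc i) (suc j) (begin
    r + suc i           ≡⟨ cong (_+ suc i) r≡ ⟩
    mirror k i + suc i  ≡⟨ mirror-complement (<k⇒<2k i<k) ⟩
    2 * k               ≡⟨ sym (mirror-complement (<k⇒<2k j<k)) ⟩
    mirror k j + suc j  ≡⟨ cong (_+ suc j) (sym r≡′) ⟩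
    r + suc j           ∎))
    where open ≡-Reasoning

  digit-cover : ∀ {r} → r < 2 * k → ∃[ j ] j < k × Digit (mirror k j) j r
  digit-cover {r} r<2k with r <? k
  ... | yes r<k = r , r<k , inj₂ refl
  ... | no r≮k  = mirror k r , mirror-≥k (≮⇒≥ r≮k) r<2k , inj₁ (sym (mirror-involutive r<2k))

  digit-< : ∀ {j r} → j < k → Digit (mirror k j) j r → r < 2 * k
  digit-< j<k (inj₁ refl) = mirror-< j<k
  digit-< j<k (inj₂ refl) = <k⇒<2k j<k

round : (d j i : ℕ) → List ℕ
round d j i = (d * i ∸ suc j) ∷ (d * (i ∸ 1) + j) ∷ []

-- Round q+1 inserts d·q + (d-1-j) and d·q + j, so m rounds build pairBlocks.
rounds-as-blocks : ∀ {d j} → j < d → ∀ m → concatMap (round d j) (oneTo m) ≡ pairBlocks d (d ∸ suc j) j m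
rounds-as-blocks j<d zero = refl
rounds-as-blocks {d} {j} j<d (suc m) = begin
  concatMap (round d j) (oneTo m ++ suc m ∷ [])
    ≡⟨ concatMap-++ (round d j) (oneTo m) (suc m ∷ []) ⟩
  concatMap (round d j) (oneTo m) ++ (d * suc m ∸ suc j) ∷ (d * m + j) ∷ []
    ≡⟨ cong₂ (λ xs y → xs ++ y ∷ (d * m + j) ∷ []) (rounds-as-blocks j<d m) upper ⟩
  pairBlocks d (d ∸ suc j) j (suc m) ∎
  where
  open ≡-Reasoning
  upper : d * suc m ∸ suc j ≡ d * m + (d ∸ suc j)
  upper = trans (cong (_∸ suc j) (trans (*-suc d m) (+-comm d (d * m)))) (+-∸-assoc (d * m) j<d)

module _ (n k t : ℕ) where

  private
    T : Fin k → List ℕ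
    T = meanderodd n k t
    m : ℕ
    m = iters n k

  meanderodd-blocks : (j : Fin k) → T j ≡ pairBlocks (2 * k) (mirror k (toℕ j)) (toℕ j) m
  meanderodd-blocks j = rounds-as-blocks (<k⇒<2k (toℕ<n j)) m

  ∈-meanderodd⁻ : ∀ j {x} → x ∈ T j → ∃₂ λ q r → q < m × Digit (mirror k (toℕ j)) (toℕ j) r × x ≡ 2 * k * q + r
  ∈-meanderodd⁻ j x∈ = ∈-pairBlocks⁻ m (subst (_ ∈_) (meanderodd-blocks j) x∈)

  ∈-meanderodd⁺ : ∀ j {q r} → q < m → Digit (mirror k (toℕ j)) (toℕ j) r → 2 * k * q + r ∈ T j
  ∈-meanderodd⁺ j q<m digit = subst (_ ∈_) (sym (meanderodd-blocks j)) (∈-pairBlocks⁺ q<m digit)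

  meanderodd-unique : (j : Fin k) → Unique (T j)
  meanderodd-unique j = subst Unique (sym (meanderodd-blocks j))
    (pairBlocks-unique (mirror≢ (toℕ<n j)) (mirror-< (toℕ<n j)) (<k⇒<2k (toℕ<n j)) m)

  -- A common element has the same remainder mod 2k in both sets, and that
  -- remainder determines the set.
  meanderodd-disjoint : (i j : Fin k) (x : ℕ) → x ∈ T i → x ∈ T j → i ≡ j
  meanderodd-disjoint i j x x∈i x∈j with ∈-meanderodd⁻ i x∈i | ∈-meanderodd⁻ j x∈j
  ... | q , r , _ , digitᵢ , x≡ | q′ , r′ , _ , digitⱼ , x≡′ =
    toℕ-injective (digit-injective (toℕ<n i) (toℕ<n j) digitᵢ (subst (Digit _ _) (sym same-remainder) digitⱼ))
    where
    same-remainder : r ≡ r′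
    same-remainder = remainder-unique (2 * k) (digit-< (toℕ<n i) digitᵢ) (digit-< (toℕ<n j) digitⱼ) (trans (sym x≡) x≡′)

  module _ (fill : n + 1 ≡ 2 * k * m) where

    meanderodd-below : ∀ j {x} → x ∈ T j → x ≤ n
    meanderodd-below j {x} x∈ = m<1+n⇒m≤n (subst (x <_) (trans (sym fill) (+-comm n 1))
      (pairBlocks-< (mirror-< (toℕ<n j)) (<k⇒<2k (toℕ<n j)) (subst (_ ∈_) (meanderodd-blocks j) x∈)))

    -- x ≤ n = 2k·m - 1 has quotient below m; its remainder picks the set.
    meanderodd-cover : 0 < k → ∀ {x} → x ≤ n → ∃[ j ] x ∈ T j
    meanderodd-cover k>0 {x} x≤n = set-of-remainder (digit-cover (m%n<n x (2 * k)))
      where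
      instance
        2k≢0 : NonZero (2 * k)
        2k≢0 = >-nonZero (<k⇒<2k k>0)
      quotient<m : x / (2 * k) < m
      quotient<m = m<n*o⇒m/o<n (≤-trans (s≤s x≤n) (≤-reflexive (trans (+-comm 1 n) (trans fill (*-comm (2 * k) m)))))
      set-of-remainder : ∃[ j ] j < k × Digit (mirror k j) j (x % (2 * k)) → ∃[ j ] x ∈ T j
      set-of-remainder (j , j<k , digit) = fromℕ< j<k , subst (_∈ T (fromℕ< j<k)) (sym (division x (2 * k)))
        (∈-meanderodd⁺ (fromℕ< j<k) quotient<m (subst (λ i → Digit (mirror k i) i _) (sym (toℕ-fromℕ< j<k)) digit))

    -- Each set sums to n·m, by pairBlocks-sum with d·m = n + 1.
    meanderodd-sum : (j : Fin k) → sum (T j) ≡ n * m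
    meanderodd-sum j = +-cancelʳ-≡ m _ _ (begin
      sum (T j) + m    ≡⟨ cong (λ xs → sum xs + m) (meanderodd-blocks j) ⟩
      sum (pairBlocks (2 * k) (mirror k (toℕ j)) (toℕ j) m) + m
                       ≡⟨ pairBlocks-sum (mirror-complement {k} (<k⇒<2k (toℕ<n j))) m ⟩
      2 * k * m * m    ≡⟨ cong (_* m) (sym fill) ⟩
      (n + 1) * m      ≡⟨ solve 2 (λ n m → (n :+ con 1) :* m := n :* m :+ m) refl n m ⟩
      n * m + m        ∎)
      where open ≡-Reasoning

  meanderodd-steps : meanderoddSteps n k t ≡ 2 * k * m
  meanderodd-steps = begin
    sum (map (λ j → length (T j)) (allFin k))  ≡⟨ sum-map-constant (allFin k) (λ j → trans (cong length (meanderodd-blocks j)) (pairBlocks-length m)) ⟩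
    length (allFin k) * (2 * m)                ≡⟨ cong (_* (2 * m)) (length-tabulate {n = k} (λ j → j)) ⟩
    k * (2 * m)                                ≡⟨ solve 2 (λ k m → k :* (con 2 :* m) := con 2 :* k :* m) refl k m ⟩
    2 * k * m                                  ∎
    where open ≡-Reasoning

rounds-fill : ∀ n k → 0 < k → 2 * k ∣ n + 1 → n + 1 ≡ 2 * k * iters n k
rounds-fill n (suc k) _ 2k∣n+1 = begin
  n + 1                  ≡⟨ n+1≡ ⟩
  c * d                  ≡⟨ *-comm c d ⟩
  d * c                  ≡⟨ cong (d *_) (sym (m*n/n≡m c d)) ⟩
  d * (c * d / d)        ≡⟨ cong (λ y → d * (y / d)) (sym n+1≡) ⟩
  d * ((n + 1) / d)      ∎
  where
  open ≡-Reasoning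
  d c : ℕ
  d = 2 * suc k
  c = quotient 2k∣n+1
  n+1≡ : n + 1 ≡ c * d
  n+1≡ = m∣n⇒n≡quotient*m 2k∣n+1

target-sum : ∀ {n k t m} → 0 < k → n + 1 ≡ 2 * k * m → n * (n + 1) ≡ 2 * (k * t) → t ≡ n * m
target-sum {n} {k} {t} {m} k>0 fill n[n+1]≡ = *-cancelˡ-≡ t (n * m) (2 * k) {{>-nonZero (<k⇒<2k k>0)}} (begin
  2 * k * t        ≡⟨ *-assoc 2 k t ⟩
  2 * (k * t)      ≡⟨ sym n[n+1]≡ ⟩
  n * (n + 1)      ≡⟨ cong (n *_) fill ⟩
  n * (2 * k * m)  ≡⟨ solve 3 (λ n k m → n :* (con 2 :* k :* m) := con 2 :* k :* (n :* m)) refl n k m ⟩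
  2 * k * (n * m)  ∎)
  where open ≡-Reasoning

meanderodd-partition : (n k t : ℕ) → 0 < k → n * (n + 1) ≡ 2 * (k * t) → 2 * k ∣ n + 1
  → ((j : Fin k) → Unique (meanderodd n k t j))
    × ((i j : Fin k) (x : ℕ) → x ∈ meanderodd n k t i → x ∈ meanderodd n k t j → i ≡ j)
    × ((x : ℕ) → (∃[ j ] x ∈ meanderodd n k t j) ⇔ x ≤ n)
    × ((j : Fin k) → sum (meanderodd n k t j) ≡ t)
meanderodd-partition n k t k>0 n[n+1]≡ 2k∣n+1 =
    meanderodd-unique n k t
  , meanderodd-disjoint n k t
  , (λ x → mk⇔ (λ (j , x∈) → meanderodd-below n k t fill j x∈) (meanderodd-cover n k t fill k>0))
  , (λ j → trans (meanderodd-sum n k t fill j) (sym (target-sum k>0 fill n[n+1]≡)))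
  where
  fill : n + 1 ≡ 2 * k * iters n k
  fill = rounds-fill n k k>0 2k∣n+1

meanderodd-linear : (n k t : ℕ) → 0 < n → 0 < k → 2 * k ∣ n + 1 → meanderoddSteps n k t ≤ 2 * n
meanderodd-linear n k t n>0 k>0 2k∣n+1 = begin
  meanderoddSteps n k t  ≡⟨ meanderodd-steps n k t ⟩
  2 * k * iters n k      ≡⟨ sym (rounds-fill n k k>0 2k∣n+1) ⟩
  n + 1                  ≤⟨ +-monoʳ-≤ n n>0 ⟩
  n + n                  ≡⟨ cong (n +_) (sym (+-identityʳ n)) ⟩
  2 * n                  ∎
  where open ≤-Reasoning

theorem2 : ((n k t : ℕ) → 0 < n → 0 < k → 0 < t → n ≤ t → n * (n + 1) ≡ 2 * (k * t) → ¬ (2 ∣ n) → 2 * k ∣ n + 1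
               → ((j : Fin k) → Unique (meanderodd n k t j))
                 × ((i j : Fin k) (x : ℕ) → x ∈ meanderodd n k t i → x ∈ meanderodd n k t j → i ≡ j)
                 × ((x : ℕ) → (∃[ j ] x ∈ meanderodd n k t j) ⇔ x ≤ n)
                 × ((j : Fin k) → sum (meanderodd n k t j) ≡ t))
             × (∃[ C ] ((n k t : ℕ) → 0 < n → 0 < k → 0 < t → n ≤ t → n * (n + 1) ≡ 2 * (k * t) → ¬ (2 ∣ n) → 2 * k ∣ n + 1
                 → meanderoddSteps n k t ≤ C * n))
theorem2 =
    (λ n k t _ k>0 _ _ n[n+1]≡ _ 2k∣n+1 → meanderodd-partition n k t k>0 n[n+1]≡ 2k∣n+1)
  , (2 , λ n k t n>0 k>0 _ _ _ _ 2k∣n+1 → meanderodd-linear n k t n>0 k>0 2k∣n+1)
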